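{- If $G$ and $H$ are graphs with $\mathrm{diam}(G)\geq3$, then $\gamma(G\diamond H)\leq\gamma(G)+2$.
   Context: All graphs are finite, simple and undirected; $\mathrm{diam}(G)$ is the maximum distance between two vertices ($\infty$ if $G$ is disconnected). The modular product $G\diamond H$ has vertex set $V(G)\times V(H)$, and two distinct vertices $(g,h)$ and $(g',h')$ are adjacent iff either ($g=g'$ and $hh'\in E(H)$), or ($gg'\in E(G)$ and $h=h'$), or ($gg'\in E(G)$ and $hh'\in E(H)$), or ($g\neq g'$, $h\neq h'$, $gg'\notin E(G)$ and $hh'\notin E(H)$). $\gamma$ is the domination number. -}

module Defs where

open import Level using (0ℓ)
open import Data.Nat using (ℕ; _*_; _≤_; _+_)
open import Data.Fin using (Fin; remQuot)
open import Data.Fin.Subset using (Subset; _∈_; ∣_∣)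
open import Data.Product using (_×_; _,_; Σ; ∃; ∃-syntax; proj₁; proj₂)
open import Data.Sum using (_⊎_)
open import Relation.Nullary using (¬_; Dec)
open import Relation.Binary.PropositionalEquality using (_≡_; _≢_)

record Graph (n : ℕ) : Set₁ where
  field
    Adj     : Fin n → Fin n → Set
    adj?    : ∀ u v → Dec (Adj u v)
    sym     : ∀ {u v} → Adj u v → Adj v u
    irrefl  : ∀ {u} → ¬ Adj u u
open Graph public

-- diam(G) ≥ 3 (with diam = ∞ for disconnected graphs): some pair of
-- vertices at distance ≥ 3, i.e. distinct, non-adjacent, with no common neighbour.
DiamAtLeast3 : ∀ {n} → Graph n → Set
DiamAtLeast3 {n} G =
  ∃[ u ] ∃[ v ] (u ≢ v × ¬ Adj G u v × ¬ (∃[ w ] (Adj G u w × Adj G w v)))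

-- Modular product G ◇ H on vertex set Fin (n * m) ≅ Fin n × Fin m (via remQuot).
ModAdj : ∀ {n m} → Graph n → Graph m → Fin n × Fin m → Fin n × Fin m → Set
ModAdj G H (g , h) (g' , h') =
     (g ≡ g' × Adj H h h')
  ⊎ ((Adj G g g' × h ≡ h')
  ⊎ ((Adj G g g' × Adj H h h')
  ⊎  (g ≢ g' × h ≢ h' × ¬ Adj G g g' × ¬ Adj H h h')))

ModAdjFin : ∀ {n m} → Graph n → Graph m → Fin (n * m) → Fin (n * m) → Set
ModAdjFin {n} {m} G H x y = ModAdj G H (remQuot m x) (remQuot m y)

Dominating : ∀ {N} → (Fin N → Fin N → Set) → Subset N → Set
Dominating {N} A D = ∀ (v : Fin N) → v ∈ D ⊎ (∃[ u ] (u ∈ D × A u v))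

IsDominationNumber : ∀ {N} → (Fin N → Fin N → Set) → ℕ → Set
IsDominationNumber {N} A k =
  (∃[ D ] (Dominating A D × ∣ D ∣ ≡ k)) × (∀ D → Dominating A D → k ≤ ∣ D ∣)

γ-is : ∀ {n} → Graph n → ℕ → Set
γ-is G k = IsDominationNumber (Adj G) k

γ◇-is : ∀ {n m} → Graph n → Graph m → ℕ → Set
γ◇-is G H k = IsDominationNumber (ModAdjFin G H) k

{-# OPTIONS --safe #-}
module Submission where

open import Defs
open import Data.Nat using (ℕ; zero; suc; _≤_; _+_; _*_; z≤n; s≤s)
open import Data.Nat.Properties
  using (≤-trans; ≤-reflexive; +-monoʳ-≤; +-suc; *-identityʳ; module ≤-Reasoning)
open import Data.Bool using (Bool; if_then_else_)
open import Data.Fin using (Fin; combine; remQuot; _≟_) renaming (zero to 0F)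
open import Data.Fin.Properties using (remQuot-combine; combine-remQuot)
open import Data.Fin.Subset using (Subset; _∈_; ∣_∣; _∪_; ⁅_⁆; ⊥; inside; outside)
open import Data.Fin.Subset.Properties
  using (∣⊥∣≡0; ∣⁅x⁆∣≡1; x∈⁅x⁆; ∣p∣≤∣x∷p∣; p⊆p∪q; q⊆p∪q)
open import Data.Vec using ([]; _∷_; _++_; concat; map; lookup)
open import Data.Vec.Properties using (lookup-concat; lookup-map; []=⇒lookup; lookup⇒[]=)
open import Data.Product using (_×_; _,_; ∃-syntax; proj₁; proj₂)
open import Data.Sum using (_⊎_; inj₁; inj₂; [_,_])
open import Function using (_∘_)
open import Relation.Nullary using (¬_; yes; no)
open import Relation.Binary.PropositionalEquality
  using (_≡_; _≢_; refl; cong; cong₂; subst; ≢-sym; module ≡-Reasoning)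
import Relation.Binary.PropositionalEquality as ≡

-- Fix h₀ ∈ V(H), a dominating set D of G and two vertices u, v of G at distance ≥ 3.
-- Then (D ∪ {u, v}) × {h₀} dominates G ◇ H: a vertex (g, h) with h = h₀ or h ~ h₀ is
-- dominated from D × {h₀} by one of the first three adjacency rules, and one with
-- h ≠ h₀, h ≁ h₀ by the fourth rule from (w, h₀), where w ∈ {u, v} is distinct from and
-- non-adjacent to g; such a w exists since u and v have disjoint closed neighbourhoods.
-- In general this gives γ(G ◇ H) ≤ γ(G) + γₜ(Ḡ), where γₜ is the total domination number.

∣p∪q∣≤∣p∣+∣q∣ : ∀ {n} (p q : Subset n) → ∣ p ∪ q ∣ ≤ ∣ p ∣ + ∣ q ∣
∣p∪q∣≤∣p∣+∣q∣ []            []            = z≤n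
∣p∪q∣≤∣p∣+∣q∣ (inside  ∷ p) (x ∷ q)       =
  s≤s (≤-trans (∣p∪q∣≤∣p∣+∣q∣ p q) (+-monoʳ-≤ ∣ p ∣ (∣p∣≤∣x∷p∣ x q)))
∣p∪q∣≤∣p∣+∣q∣ (outside ∷ p) (inside  ∷ q) =
  ≤-trans (s≤s (∣p∪q∣≤∣p∣+∣q∣ p q)) (≤-reflexive (≡.sym (+-suc ∣ p ∣ ∣ q ∣)))
∣p∪q∣≤∣p∣+∣q∣ (outside ∷ p) (outside ∷ q) = ∣p∪q∣≤∣p∣+∣q∣ p q

∣p++q∣≡∣p∣+∣q∣ : ∀ {n m} (p : Subset n) (q : Subset m) → ∣ p ++ q ∣ ≡ ∣ p ∣ + ∣ q ∣
∣p++q∣≡∣p∣+∣q∣ []            q = refl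
∣p++q∣≡∣p∣+∣q∣ (inside  ∷ p) q = cong suc (∣p++q∣≡∣p∣+∣q∣ p q)
∣p++q∣≡∣p∣+∣q∣ (outside ∷ p) q = ∣p++q∣≡∣p∣+∣q∣ p q

-- (g , h) sits at index combine g h, inverting the remQuot used by ModAdjFin.
_⊗_ : ∀ {n m} → Subset n → Subset m → Subset (n * m)
p ⊗ q = concat (map (λ b → if b then q else ⊥) p)

∣p⊗q∣≡∣p∣*∣q∣ : ∀ {n m} (p : Subset n) (q : Subset m) → ∣ p ⊗ q ∣ ≡ ∣ p ∣ * ∣ q ∣
∣p⊗q∣≡∣p∣*∣q∣         []            q = refl
∣p⊗q∣≡∣p∣*∣q∣         (inside  ∷ p) q =
  ≡.trans (∣p++q∣≡∣p∣+∣q∣ q (p ⊗ q)) (cong (∣ q ∣ +_) (∣p⊗q∣≡∣p∣*∣q∣ p q))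
∣p⊗q∣≡∣p∣*∣q∣ {m = m} (outside ∷ p) q =
  ≡.trans (∣p++q∣≡∣p∣+∣q∣ (⊥ {n = m}) (p ⊗ q)) (cong₂ _+_ (∣⊥∣≡0 m) (∣p⊗q∣≡∣p∣*∣q∣ p q))

combine∈⊗ : ∀ {n m} {p : Subset n} {q : Subset m} {g h} →
            g ∈ p → h ∈ q → combine g h ∈ p ⊗ q
combine∈⊗ {m = m} {p = p} {q} {g} {h} g∈p h∈q = lookup⇒[]= (combine g h) (p ⊗ q) (begin
  lookup (concat (map row p)) (combine g h) ≡⟨ lookup-concat (map row p) g h ⟩
  lookup (lookup (map row p) g) h           ≡⟨ cong (λ r → lookup r h) (lookup-map g row p) ⟩
  lookup (row (lookup p g)) h               ≡⟨ cong (λ b → lookup (row b) h) ([]=⇒lookup g∈p) ⟩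
  lookup q h                                ≡⟨ []=⇒lookup h∈q ⟩
  inside                                    ∎)
  where
  open ≡-Reasoning
  row : Bool → Subset m
  row b = if b then q else ⊥

Adjᶜ : ∀ {n} → Graph n → Fin n → Fin n → Set
Adjᶜ G u v = u ≢ v × ¬ Adj G u v

TotallyDominating : ∀ {N} → (Fin N → Fin N → Set) → Subset N → Set
TotallyDominating {N} A F = ∀ (v : Fin N) → ∃[ u ] (u ∈ F × A u v)

far-pair-totally-dominatesᶜ : ∀ {n} (G : Graph n) {u v} → u ≢ v → ¬ Adj G u v →
  ¬ (∃[ w ] (Adj G u w × Adj G w v)) → TotallyDominating (Adjᶜ G) (⁅ u ⁆ ∪ ⁅ v ⁆)
far-pair-totally-dominatesᶜ G {u} {v} u≢v u≁v noCommon g with u ≟ g | adj? G u g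
... | yes refl | _        = v , q⊆p∪q ⁅ u ⁆ ⁅ v ⁆ (x∈⁅x⁆ v) , ≢-sym u≢v , u≁v ∘ sym G
... | no u≢g   | no u≁g   = u , p⊆p∪q ⁅ v ⁆ (x∈⁅x⁆ u) , u≢g , u≁g
... | no _     | yes u~g  =
  v , q⊆p∪q ⁅ u ⁆ ⁅ v ⁆ (x∈⁅x⁆ v) , (λ { refl → u≁v u~g }) ,
  (λ v~g → noCommon (g , u~g , sym G v~g))

module _ {n m} (G : Graph n) (H : Graph m) where

  DominatingPairs : Subset (n * m) → Set
  DominatingPairs S = ∀ g h →
    combine g h ∈ S ⊎ ∃[ u ] (u ∈ S × ModAdj G H (remQuot m u) (g , h))

  dominatingPairs⇒dominating : ∀ {S} → DominatingPairs S → Dominating (ModAdjFin G H) S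
  dominatingPairs⇒dominating {S} dom x
    with dom (proj₁ (remQuot {n} m x)) (proj₂ (remQuot {n} m x))
  ... | inj₁ gh∈S = inj₁ (subst (_∈ S) (combine-remQuot {n} m x) gh∈S)
  ... | inj₂ u~x  = inj₂ u~x

  module _ {D F} (domD : Dominating (Adj G) D) (totF : TotallyDominating (Adjᶜ G) F)
           (h₀ : Fin m) where

    dominated-from-row : ∀ g h →
      (g ∈ D ∪ F × h ≡ h₀) ⊎ ∃[ w ] (w ∈ D ∪ F × ModAdj G H (w , h₀) (g , h))
    dominated-from-row g h with h ≟ h₀ | adj? H h₀ h | domD g
    ... | yes refl | _        | inj₁ g∈D             = inj₁ (p⊆p∪q F g∈D , refl)
    ... | yes refl | _        | inj₂ (d , d∈D , d~g) =
      inj₂ (d , p⊆p∪q F d∈D , inj₂ (inj₁ (d~g , refl)))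
    ... | no _     | yes h₀~h | inj₁ g∈D             =
      inj₂ (g , p⊆p∪q F g∈D , inj₁ (refl , h₀~h))
    ... | no _     | yes h₀~h | inj₂ (d , d∈D , d~g) =
      inj₂ (d , p⊆p∪q F d∈D , inj₂ (inj₂ (inj₁ (d~g , h₀~h))))
    ... | no h≢h₀  | no h₀≁h  | _ with totF g
    ...   | w , w∈F , w≢g , w≁g =
      inj₂ (w , q⊆p∪q D F w∈F , inj₂ (inj₂ (inj₂ (w≢g , ≢-sym h≢h₀ , w≁g , h₀≁h))))

    row-dominating : Dominating (ModAdjFin G H) ((D ∪ F) ⊗ ⁅ h₀ ⁆)
    row-dominating = dominatingPairs⇒dominating λ g h →
      [ (λ { (g∈D∪F , refl) → inj₁ (combine∈⊗ g∈D∪F (x∈⁅x⁆ h₀)) })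
      , (λ { (w , w∈D∪F , w~g) → inj₂ (combine w h₀ , combine∈⊗ w∈D∪F (x∈⁅x⁆ h₀) ,
                                        subst (λ p → ModAdj G H p (g , h))
                                              (≡.sym (remQuot-combine w h₀)) w~g) })
      ] (dominated-from-row g h)

⊥-dominates-◇-empty : ∀ {n} (G : Graph n) (H : Graph 0) → Dominating (ModAdjFin G H) ⊥
⊥-dominates-◇-empty {n} G H x with () ← remQuot {n} 0 x

γ◇≤γ+∣F∣ : ∀ {n m} (G : Graph n) (H : Graph m) {F k l} →
  TotallyDominating (Adjᶜ G) F → γ-is G k → γ◇-is G H l → l ≤ k + ∣ F ∣
γ◇≤γ+∣F∣ {n} {zero} G H _ _ (_ , minimal) = begin
  _                  ≤⟨ minimal ⊥ (⊥-dominates-◇-empty G H) ⟩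
  ∣ ⊥ {n = n * 0} ∣  ≡⟨ ∣⊥∣≡0 (n * 0) ⟩
  0                  ≤⟨ z≤n ⟩
  _                  ∎
  where open ≤-Reasoning
γ◇≤γ+∣F∣ {m = suc m} G H {F} totF ((D , domD , refl) , _) (_ , minimal) = begin
  _                        ≤⟨ minimal _ (row-dominating G H domD totF h₀) ⟩
  ∣ (D ∪ F) ⊗ ⁅ h₀ ⁆ ∣     ≡⟨ ∣p⊗q∣≡∣p∣*∣q∣ (D ∪ F) ⁅ h₀ ⁆ ⟩
  ∣ D ∪ F ∣ * ∣ ⁅ h₀ ⁆ ∣   ≡⟨ cong (∣ D ∪ F ∣ *_) (∣⁅x⁆∣≡1 h₀) ⟩
  ∣ D ∪ F ∣ * 1            ≡⟨ *-identityʳ ∣ D ∪ F ∣ ⟩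
  ∣ D ∪ F ∣                ≤⟨ ∣p∪q∣≤∣p∣+∣q∣ D F ⟩
  ∣ D ∣ + ∣ F ∣            ∎
  where
  open ≤-Reasoning
  h₀ : Fin (suc m)
  h₀ = 0F

∣⁅x⁆∪⁅y⁆∣≤2 : ∀ {n} (x y : Fin n) → ∣ ⁅ x ⁆ ∪ ⁅ y ⁆ ∣ ≤ 2
∣⁅x⁆∪⁅y⁆∣≤2 x y = ≤-trans (∣p∪q∣≤∣p∣+∣q∣ ⁅ x ⁆ ⁅ y ⁆)
                          (≤-reflexive (cong₂ _+_ (∣⁅x⁆∣≡1 x) (∣⁅x⁆∣≡1 y)))

corollary15 : ∀ {n m} (G : Graph n) (H : Graph m) → DiamAtLeast3 G →
    ∀ (k l : ℕ) → γ-is G k → γ◇-is G H l → l ≤ k + 2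
corollary15 G H (u , v , u≢v , u≁v , noCommon) k l γG γ◇ =
  ≤-trans (γ◇≤γ+∣F∣ G H (far-pair-totally-dominatesᶜ G u≢v u≁v noCommon) γG γ◇)
          (+-monoʳ-≤ k (∣⁅x⁆∪⁅y⁆∣≤2 u v))
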